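{- Let $p$ be an odd integer with $|p|>1$ and let $m\ge1$ be an odd integer coprime to $p$, and let $j\ge0$ be an integer. If $l_p(m)$ is odd, then $2^jm\in\mathcal{B}_{p,0}$ if and only if $j=1+v_2(p-1)$ or $j>v_2(p^2-1)$. If $l_p(m)$ is even, then $2^jm\in\mathcal{B}_{p,0}$ if and only if $j>v_2(p^{l_p(m)}-1)$.
   Context: $l_p(m)$ is the multiplicative order of $p$ modulo $m$ (so $l_p(1)=1$). $v_2(n)$ is the exponent of the largest power of $2$ dividing $n$. For $d$ coprime to $p$, $\langle p\rangle_d$ is the cyclic subgroup of $(\mathbb{Z}/d\mathbb{Z})^\times$ generated by $p$, and $\mathcal{B}_{p,0}=\{d>2:\gcd(d,p)=1,\ 4\mid d,\ \tfrac12d+1\in\langle p\rangle_d\}$. -}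

module Defs where

open import Data.Nat as ℕ using (ℕ; suc; _≤_; _<_)
open import Data.Nat.DivMod using (_/_)
open import Data.Nat.Coprimality using (Coprime)
open import Data.Nat.Divisibility using () renaming (_∣_ to _∣ℕ_)
open import Data.Integer as ℤ using (ℤ; +_; _-_; _^_; ∣_∣)
open import Data.Integer.Divisibility using () renaming (_∣_ to _∣ℤ_)
open import Data.Product using (Σ; _×_; ∃)
open import Relation.Nullary using (¬_)

-- l_p(m) = k : k is the multiplicative order of p modulo m
-- (least k ≥ 1 with p^k ≡ 1 mod m; so l_p(1) = 1).
IsOrder : ℤ → ℕ → ℕ → Set
IsOrder p m k =
  (1 ≤ k) × ((+ m) ∣ℤ (p ^ k - + 1)) ×
  (∀ k′ → 1 ≤ k′ → k′ < k → ¬ ((+ m) ∣ℤ (p ^ k′ - + 1)))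

-- v₂(n) = a : 2^a ∣ n and 2^(a+1) ∤ n  (meaningful for n ≠ 0)
IsV2 : ℤ → ℕ → Set
IsV2 n a = ((+ (2 ℕ.^ a)) ∣ℤ n) × ¬ ((+ (2 ℕ.^ suc a)) ∣ℤ n)

InPowers : ℤ → ℕ → ℕ → Set
InPowers p d x = ∃ λ (k : ℕ) → (+ d) ∣ℤ (p ^ k - + x)

InB : ℤ → ℕ → Set
InB p d = (2 < d) × Coprime d ∣ p ∣ × (4 ∣ℕ d) × InPowers p d (d / 2 ℕ.+ 1)

{-# OPTIONS --safe #-}
module Submission where

-- Write d = 2^(e+1) m with m odd. Then d/2 + 1 = 2^e m + 1, and the congruence
-- p^k ≡ 2^e m + 1 (mod d) splits into p^k ≡ 1 (mod m), i.e. l_p(m) ∣ k, and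
-- v₂(p^k − 1) = e. So 2^j m ∈ 𝓑_{p,0} exactly when j − 1 is one of the values
-- v₂(p^k − 1) with l_p(m) ∣ k. For odd x and odd n, v₂(x^n − 1) = v₂(x − 1), and
-- squaring raises a valuation v₂(x − 1) ≥ 2 by exactly one. Hence for odd l_p(m)
-- these values are v₂(p − 1) (odd k) and all e ≥ v₂(p² − 1) (even k), while for
-- even l_p(m) they are all e ≥ v₂(p^l − 1).

module TwoAdicValuation where

  open import Defs using (IsV2)
  open import Data.Integer using (ℤ; +_; _+_; _-_; _*_; _^_; NonZero)
  import Data.Integer.Properties as ℤ
  open import Data.Integer.Divisibility using () renaming (_∣_ to _∣ᵤ_)
  open import Data.Integer.Divisibility.Signed
    using (_∣_; _∣?_; divides; ∣-refl; ∣-trans; ∣n⇒∣m*n; ∣m∣n⇒∣m+n; ∣m+n∣n⇒∣m; *-cancelʳ-∣; ∣ᵤ⇒∣; ∣⇒∣ᵤ)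
  open import Data.Integer.DivMod using (_%ℕ_; _/ℕ_; a≡a%ℕn+[a/ℕn]*n; n%ℕd<d)
  open import Data.Integer.Tactic.RingSolver using (solve-∀)
  open import Data.Nat as ℕ using (ℕ; zero; suc; z≤n; s≤s)
  import Data.Nat.Properties as ℕ
  import Data.Nat.Divisibility as ℕ
  open import Data.Product using (_,_)
  open import Function using (_∘_)
  open import Relation.Nullary using (¬_; yes; no; contradiction)
  open import Relation.Binary.PropositionalEquality

  infix 8 2^_
  2^_ : ℕ → ℤ
  2^ e = (+ 2) ^ e

  -- A record rather than a Σ-type, so that the exponent can be inferred from it.
  infix 4 _hasV₂_
  record _hasV₂_ (x : ℤ) (e : ℕ) : Set where
    constructor odd-part
    field
      oddPart       : ℤ
      factorisation : x ≡ (+ 1 + + 2 * oddPart) * 2^ e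

  pos-2^ : ∀ e → + (2 ℕ.^ e) ≡ 2^ e
  pos-2^ zero    = refl
  pos-2^ (suc e) = trans (ℤ.pos-* 2 (2 ℕ.^ e)) (cong (+ 2 *_) (pos-2^ e))

  2^≢0 : ∀ e → NonZero (2^ e)
  2^≢0 e = subst NonZero (pos-2^ e) (ℕ.m^n≢0 2 e)

  2^∣2^ : ∀ {e f} → e ℕ.≤ f → 2^ e ∣ 2^ f
  2^∣2^ {e} e≤f with ℕ.m≤n⇒∃[o]m+o≡n e≤f
  ... | g , refl = divides (2^ g) (trans (ℤ.^-distribˡ-+-* (+ 2) e g) (ℤ.*-comm (2^ e) (2^ g)))

  2∤1+2* : ∀ t → ¬ (+ 2 ∣ + 1 + + 2 * t)
  2∤1+2* t 2∣1+2t with ℕ.∣1⇒≡1 (∣⇒∣ᵤ (∣m+n∣n⇒∣m {+ 2} {+ 1} {+ 2 * t} 2∣1+2t (divides t (ℤ.*-comm (+ 2) t))))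
  ... | ()

  2^-hasV₂ : ∀ e → 2^ e hasV₂ e
  2^-hasV₂ e = odd-part (+ 0) (factor (2^ e))
    where
    factor : ∀ E → E ≡ (+ 1 + + 2 * + 0) * E
    factor = solve-∀

  ¬2∣⇒hasV₂0 : ∀ {x} → ¬ (+ 2 ∣ᵤ x) → x hasV₂ 0
  ¬2∣⇒hasV₂0 {x} 2∤x = by-remainder (x %ℕ 2) (n%ℕd<d x 2) (a≡a%ℕn+[a/ℕn]*n x 2)
    where
    odd-form : ∀ q → + 1 + q * + 2 ≡ (+ 1 + + 2 * q) * + 1
    odd-form = solve-∀
    by-remainder : ∀ r → r ℕ.< 2 → x ≡ + r + x /ℕ 2 * + 2 → x hasV₂ 0
    by-remainder 0 _ x≡ = contradiction (∣⇒∣ᵤ (divides (x /ℕ 2) (trans x≡ (ℤ.+-identityˡ _)))) 2∤x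
    by-remainder 1 _ x≡ = odd-part (x /ℕ 2) (trans x≡ (odd-form (x /ℕ 2)))
    by-remainder (suc (suc _)) (s≤s (s≤s ())) _

  hasV₂⇒2^∣ : ∀ {x e} → x hasV₂ e → 2^ e ∣ x
  hasV₂⇒2^∣ (odd-part t x≡) = divides (+ 1 + + 2 * t) x≡

  hasV₂⇒2^suc∤ : ∀ {x e} → x hasV₂ e → ¬ (2^ suc e ∣ x)
  hasV₂⇒2^suc∤ {e = e} (odd-part t refl) 2^suc∣x =
    2∤1+2* t (*-cancelʳ-∣ (2^ e) {+ 2} {+ 1 + + 2 * t} {{2^≢0 e}} 2^suc∣x)

  hasV₂-≤ : ∀ {x e f} → x hasV₂ e → 2^ f ∣ x → f ℕ.≤ e
  hasV₂-≤ {e = e} {f} v 2^f∣x with f ℕ.≤? e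
  ... | yes f≤e = f≤e
  ... | no  f≰e = contradiction (∣-trans (2^∣2^ {suc e} {f} (ℕ.≰⇒> f≰e)) 2^f∣x) (hasV₂⇒2^suc∤ v)

  hasV₂-unique : ∀ {x e f} → x hasV₂ e → x hasV₂ f → e ≡ f
  hasV₂-unique ve vf = ℕ.≤-antisym (hasV₂-≤ vf (hasV₂⇒2^∣ ve)) (hasV₂-≤ ve (hasV₂⇒2^∣ vf))

  hasV₂-* : ∀ {x y e f} → x hasV₂ e → y hasV₂ f → x * y hasV₂ e ℕ.+ f
  hasV₂-* {e = e} {f} (odd-part s refl) (odd-part t refl) = odd-part u (begin
    (+ 1 + + 2 * s) * 2^ e * ((+ 1 + + 2 * t) * 2^ f) ≡⟨ regroup s t (2^ e) (2^ f) ⟩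
    (+ 1 + + 2 * u) * (2^ e * 2^ f)                   ≡⟨ cong ((+ 1 + + 2 * u) *_) (ℤ.^-distribˡ-+-* (+ 2) e f) ⟨
    (+ 1 + + 2 * u) * 2^ (e ℕ.+ f)                    ∎)
    where
    open ≡-Reasoning
    u : ℤ
    u = s + t + + 2 * s * t
    regroup : ∀ s t E F → (+ 1 + + 2 * s) * E * ((+ 1 + + 2 * t) * F)
                        ≡ (+ 1 + + 2 * (s + t + + 2 * s * t)) * (E * F)
    regroup = solve-∀

  hasV₂-+ : ∀ {x y e} → x hasV₂ e → 2^ suc e ∣ y → x + y hasV₂ e
  hasV₂-+ {e = e} (odd-part t refl) (divides q refl) = odd-part (t + q) (regroup t q (2^ e))
    where
    regroup : ∀ t q E → (+ 1 + + 2 * t) * E + q * (+ 2 * E) ≡ (+ 1 + + 2 * (t + q)) * E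
    regroup = solve-∀

  hasV₂0-^ : ∀ {x} → x hasV₂ 0 → ∀ n → x ^ n hasV₂ 0
  hasV₂0-^ x-odd zero    = 2^-hasV₂ 0
  hasV₂0-^ x-odd (suc n) = hasV₂-* x-odd (hasV₂0-^ x-odd n)

  IsV2⇒hasV₂ : ∀ {x e} → IsV2 x e → x hasV₂ e
  IsV2⇒hasV₂ {x} {e} (2^e∣x , 2^suc∤x) with subst (_∣ x) (pos-2^ e) (∣ᵤ⇒∣ 2^e∣x)
  ... | divides q refl with + 2 ∣? q
  ...   | yes (divides r refl) = contradiction
    (subst (_∣ x) (sym (pos-2^ (suc e))) (divides r (ℤ.*-assoc r (+ 2) (2^ e)))) (2^suc∤x ∘ ∣⇒∣ᵤ)
  ...   | no  q-odd = hasV₂-* {q} (¬2∣⇒hasV₂0 (q-odd ∘ ∣ᵤ⇒∣)) (2^-hasV₂ e)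

  odd∣2*⇒∣ : ∀ {M y} → M hasV₂ 0 → M ∣ + 2 * y → M ∣ y
  odd∣2*⇒∣ {y = y} (odd-part r refl) (divides q 2y≡) = divides (y - r * q) (begin
    y                     ≡⟨ expand r y ⟩
    y * M - r * (+ 2 * y) ≡⟨ cong (λ z → y * M - r * z) 2y≡ ⟩
    y * M - r * (q * M)   ≡⟨ regroup y r q M ⟩
    (y - r * q) * M       ∎)
    where
    open ≡-Reasoning
    M : ℤ
    M = (+ 1 + + 2 * r) * + 1
    expand : ∀ r y → y ≡ y * ((+ 1 + + 2 * r) * + 1) - r * (+ 2 * y)
    expand = solve-∀
    regroup : ∀ y r q M → y * M - r * (q * M) ≡ (y - r * q) * M
    regroup = solve-∀

  odd∣2^*⇒∣ : ∀ {M y} → M hasV₂ 0 → ∀ n → M ∣ 2^ n * y → M ∣ y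
  odd∣2^*⇒∣ {M} {y} M-odd zero    M∣y       = subst (M ∣_) (ℤ.*-identityˡ y) M∣y
  odd∣2^*⇒∣ {M} {y} M-odd (suc n) M∣2^suc*y = odd∣2^*⇒∣ M-odd n
    (odd∣2*⇒∣ M-odd (subst (M ∣_) (ℤ.*-assoc (+ 2) (2^ n) y) M∣2^suc*y))

  ∣x-1⇒∣x^n-1 : ∀ {d x} → d ∣ x - + 1 → ∀ n → d ∣ x ^ n - + 1
  ∣x-1⇒∣x^n-1 _ zero = divides (+ 0) refl
  ∣x-1⇒∣x^n-1 {d} {x} d∣x-1 (suc n) = subst (d ∣_) (split x (x ^ n))
    (∣m∣n⇒∣m+n (∣n⇒∣m*n x (∣x-1⇒∣x^n-1 d∣x-1 n)) d∣x-1)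
    where
    split : ∀ x X → x * (X - + 1) + (x - + 1) ≡ x * X - + 1
    split = solve-∀

  ^-1∣^*-1 : ∀ x a n → x ^ a - + 1 ∣ x ^ (n ℕ.* a) - + 1
  ^-1∣^*-1 x a n = subst (λ y → x ^ a - + 1 ∣ y - + 1)
    (trans (ℤ.^-*-assoc x a n) (cong (x ^_) (ℕ.*-comm a n))) (∣x-1⇒∣x^n-1 ∣-refl n)

  odd⇒2∣x-1 : ∀ {x} → x hasV₂ 0 → 2^ 1 ∣ x - + 1
  odd⇒2∣x-1 (odd-part t refl) = divides t (factor t)
    where
    factor : ∀ t → (+ 1 + + 2 * t) * + 1 - + 1 ≡ t * (+ 2 * + 1)
    factor = solve-∀

  odd⇒2^suc∣x²-1 : ∀ {x e} → x hasV₂ 0 → 2^ e ∣ x - + 1 → 2^ suc e ∣ x ^ 2 - + 1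
  odd⇒2^suc∣x²-1 {e = e} (odd-part t refl) (divides q x-1≡) = divides (q * (t + + 1)) (begin
    x * (x * + 1) - + 1           ≡⟨ factor t ⟩
    (x - + 1) * (+ 2 * (t + + 1)) ≡⟨ cong (_* (+ 2 * (t + + 1))) x-1≡ ⟩
    q * 2^ e * (+ 2 * (t + + 1))  ≡⟨ regroup q t (2^ e) ⟩
    q * (t + + 1) * (+ 2 * 2^ e)  ∎)
    where
    open ≡-Reasoning
    x : ℤ
    x = (+ 1 + + 2 * t) * + 1
    factor : ∀ t → let x = (+ 1 + + 2 * t) * + 1 in
      x * (x * + 1) - + 1 ≡ (x - + 1) * (+ 2 * (t + + 1))
    factor = solve-∀
    regroup : ∀ q t E → q * E * (+ 2 * (t + + 1)) ≡ q * (t + + 1) * (+ 2 * E)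
    regroup = solve-∀

  odd⇒4∣x²-1 : ∀ {x} → x hasV₂ 0 → 2^ 2 ∣ x ^ 2 - + 1
  odd⇒4∣x²-1 x-odd = odd⇒2^suc∣x²-1 {e = 1} x-odd (odd⇒2∣x-1 x-odd)

  -- x^(n+2) − 1 = x² (x^n − 1) + (x² − 1), and v₂(x² − 1) > v₂(x − 1) for odd x.
  hasV₂-^-odd : ∀ {x e} → x hasV₂ 0 → x - + 1 hasV₂ e → ∀ n → ¬ 2 ℕ.∣ n → x ^ n - + 1 hasV₂ e
  hasV₂-^-odd x-odd v zero n-odd = contradiction (2 ℕ.∣0) n-odd
  hasV₂-^-odd {x} {e} x-odd v 1 _ = subst (λ y → y - + 1 hasV₂ e) (sym (ℤ.^-identityʳ x)) v
  hasV₂-^-odd {x} {e} x-odd v (suc (suc n)) 2+n-odd = subst (_hasV₂ e) (split x (x ^ n))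
    (hasV₂-+ (hasV₂-* (hasV₂0-^ x-odd 2) (hasV₂-^-odd x-odd v n n-odd))
             (odd⇒2^suc∣x²-1 {e = e} x-odd (hasV₂⇒2^∣ v)))
    where
    n-odd : ¬ 2 ℕ.∣ n
    n-odd = 2+n-odd ∘ ℕ.∣m∣n⇒∣m+n (ℕ.∣-refl {2})
    split : ∀ x X → x * (x * + 1) * (X - + 1) + (x * (x * + 1) - + 1) ≡ x * (x * X) - + 1
    split = solve-∀

  -- x² − 1 = (x + 1)(x − 1), and 4 ∣ x − 1 makes v₂(x + 1) = 1.
  hasV₂-square : ∀ {x e} → x - + 1 hasV₂ suc (suc e) → x ^ 2 - + 1 hasV₂ suc (suc (suc e))
  hasV₂-square {x} {e} v = subst (_hasV₂ suc (suc (suc e))) (factor x) (hasV₂-* x+1-hasV₂1 v)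
    where
    x+1-hasV₂1 : 2^ 1 + (x - + 1) hasV₂ 1
    x+1-hasV₂1 = hasV₂-+ (2^-hasV₂ 1) (∣-trans (2^∣2^ {2} {suc (suc e)} (s≤s (s≤s z≤n))) (hasV₂⇒2^∣ v))
    factor : ∀ x → (+ 2 * + 1 + (x - + 1)) * (x - + 1) ≡ x * (x * + 1) - + 1
    factor = solve-∀

module MembershipInB where

  open import Defs
  open TwoAdicValuation
  open import Data.Integer using (ℤ; +_; _+_; _-_; _*_; _^_; ∣_∣)
  import Data.Integer.Properties as ℤ
  open import Data.Integer.Divisibility.Signed
    using (_∣_; divides; quotient; ∣-trans; ∣n⇒∣m*n; ∣m+n∣m⇒∣n; ∣ᵤ⇒∣; ∣⇒∣ᵤ)
  open import Data.Integer.Tactic.RingSolver using (solve-∀)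
  open import Data.Nat as ℕ using (ℕ; zero; suc; z≤n; s≤s; _≤′_; ≤′-refl; ≤′-step)
  import Data.Nat.Properties as ℕ
  import Data.Nat.Divisibility as ℕ
  open import Data.Nat.DivMod using (_%_; _/_; m≡m%n+[m/n]*n; m%n<n; m*n/n≡m)
  open import Data.Nat.Coprimality using (Coprime)
  open import Data.Empty using (⊥-elim)
  open import Data.Product using (∃; _×_; _,_)
  open import Data.Sum using (_⊎_; inj₁; inj₂)
  open import Function using (_∘_; id)
  open import Function.Bundles using (_⇔_; mk⇔; Equivalence)
  import Function.Properties.Equivalence as ⇔
  open import Relation.Nullary using (¬_; yes; no; contradiction)
  open import Relation.Binary.PropositionalEquality

  order-∣ : ∀ {p m l k} → IsOrder p m l → + m ∣ p ^ k - + 1 → l ℕ.∣ k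
  order-∣ {p} {m} {l} {k} (s≤s z≤n , m∣p^l-1 , minimal) m∣p^k-1 =
    from-remainder (k % l) (m%n<n k l) (m≡m%n+[m/n]*n k l)
    where
    from-remainder : ∀ r → r ℕ.< l → k ≡ r ℕ.+ k / l ℕ.* l → l ℕ.∣ k
    from-remainder zero    _   k≡ = ℕ.divides (k / l) k≡
    from-remainder (suc r) r<l k≡ = contradiction (∣⇒∣ᵤ m∣p^r-1) (minimal (suc r) (s≤s z≤n) r<l)
      where
      P Q : ℤ
      P = p ^ suc r
      Q = p ^ (k / l ℕ.* l)
      split : ∀ P Q → P * Q - + 1 ≡ P * (Q - + 1) + (P - + 1)
      split = solve-∀
      p^k-1≡ : p ^ k - + 1 ≡ P * (Q - + 1) + (P - + 1)
      p^k-1≡ = trans (cong (λ n → p ^ n - + 1) k≡)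
                     (trans (cong (_- + 1) (ℤ.^-distribˡ-+-* p (suc r) (k / l ℕ.* l))) (split P Q))
      m∣p^r-1 : + m ∣ P - + 1
      m∣p^r-1 = ∣m+n∣m⇒∣n (subst (+ m ∣_) p^k-1≡ m∣p^k-1)
                          (∣n⇒∣m*n P (∣-trans (∣ᵤ⇒∣ m∣p^l-1) (^-1∣^*-1 p l (k / l))))

  ≡half+1-mod⇔ : ∀ {M y} e → M hasV₂ 0 →
    (2^ suc e * M ∣ y - (2^ e * M + + 1)) ⇔ (M ∣ y - + 1 × y - + 1 hasV₂ e)
  ≡half+1-mod⇔ {y = y} e (odd-part r refl) = mk⇔ to from
    where
    open ≡-Reasoning
    E M : ℤ
    E = 2^ e
    M = (+ 1 + + 2 * r) * + 1
    shift : ∀ y E M → y - (E * M + + 1) ≡ y - + 1 - E * M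
    shift = solve-∀
    to : 2^ suc e * M ∣ y - (E * M + + 1) → M ∣ y - + 1 × y - + 1 hasV₂ e
    to (divides q D≡) = divides (q * + 2 * E + E) (trans y-1≡ (as-multiple q r E))
                      , odd-part (r + q + + 2 * r * q) (trans y-1≡ (as-valuation q r E))
      where
      unshift : ∀ y E M → y - + 1 ≡ y - (E * M + + 1) + E * M
      unshift = solve-∀
      y-1≡ : y - + 1 ≡ q * (+ 2 * E * M) + E * M
      y-1≡ = trans (unshift y E M) (cong (_+ E * M) D≡)
      as-multiple : ∀ q r E → let M = (+ 1 + + 2 * r) * + 1 in
        q * (+ 2 * E * M) + E * M ≡ (q * + 2 * E + E) * M
      as-multiple = solve-∀
      as-valuation : ∀ q r E → let M = (+ 1 + + 2 * r) * + 1 in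
        q * (+ 2 * E * M) + E * M ≡ (+ 1 + + 2 * (r + q + + 2 * r * q)) * E
      as-valuation = solve-∀
    -- The difference is 2^(e+1) (t − r) and is divisible by the odd M, hence so is t − r.
    from : M ∣ y - + 1 × y - + 1 hasV₂ e → 2^ suc e * M ∣ y - (E * M + + 1)
    from (divides w y-1≡wM , odd-part t y-1≡) = divides z (begin
      y - (E * M + + 1)   ≡⟨ D≡ ⟩
      (t - r) * (+ 2 * E) ≡⟨ cong (_* (+ 2 * E)) t-r≡zM ⟩
      z * M * (+ 2 * E)   ≡⟨ regroup z M E ⟩
      z * (+ 2 * E * M)   ∎)
      where
      via-valuation : ∀ t r E → (+ 1 + + 2 * t) * E - E * ((+ 1 + + 2 * r) * + 1) ≡ (t - r) * (+ 2 * E)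
      via-valuation = solve-∀
      via-multiple : ∀ w E M → w * M - E * M ≡ (w - E) * M
      via-multiple = solve-∀
      regroup : ∀ z M E → z * M * (+ 2 * E) ≡ z * (+ 2 * E * M)
      regroup = solve-∀
      D≡ : y - (E * M + + 1) ≡ (t - r) * (+ 2 * E)
      D≡ = trans (shift y E M) (trans (cong (_- E * M) y-1≡) (via-valuation t r E))
      M∣2^suc*[t-r] : M ∣ 2^ suc e * (t - r)
      M∣2^suc*[t-r] = divides (w - E) (begin
        2^ suc e * (t - r)  ≡⟨ ℤ.*-comm (2^ suc e) (t - r) ⟩
        (t - r) * (+ 2 * E) ≡⟨ D≡ ⟨
        y - (E * M + + 1)   ≡⟨ shift y E M ⟩
        y - + 1 - E * M     ≡⟨ cong (_- E * M) y-1≡wM ⟩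
        w * M - E * M       ≡⟨ via-multiple w E M ⟩
        (w - E) * M         ∎)
      M∣t-r : M ∣ t - r
      M∣t-r = odd∣2^*⇒∣ (odd-part r refl) (suc e) M∣2^suc*[t-r]
      z : ℤ
      z = quotient M∣t-r
      t-r≡zM : t - r ≡ z * M
      t-r≡zM = _∣_.equality M∣t-r

  pos-2^*n : ∀ e n → + (2 ℕ.^ e ℕ.* n) ≡ 2^ e * + n
  pos-2^*n e n = trans (ℤ.pos-* (2 ℕ.^ e) n) (cong (_* + n) (pos-2^ e))

  2^suc*n/2 : ∀ e n → 2 ℕ.^ suc e ℕ.* n / 2 ≡ 2 ℕ.^ e ℕ.* n
  2^suc*n/2 e n = trans (cong (_/ 2) (trans (ℕ.*-assoc 2 (2 ℕ.^ e) n) (ℕ.*-comm 2 (2 ℕ.^ e ℕ.* n))))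
                        (m*n/n≡m (2 ℕ.^ e ℕ.* n) 2)

  coprime-2^* : ∀ {m n} → ¬ 2 ℕ.∣ n → Coprime m n → ∀ j → Coprime (2 ℕ.^ j ℕ.* m) n
  coprime-2^* {m} {n} n-odd m⊥n j {i} (i∣2^j*m , i∣n) = m⊥n (i∣m , i∣n)
    where
    i-odd : + i hasV₂ 0
    i-odd = ¬2∣⇒hasV₂0 (λ 2∣i → n-odd (ℕ.∣-trans 2∣i i∣n))
    i∣m : i ℕ.∣ m
    i∣m = ∣⇒∣ᵤ (odd∣2^*⇒∣ i-odd j (subst (+ i ∣_) (pos-2^*n j m) (∣ᵤ⇒∣ {+ i} {+ (2 ℕ.^ j ℕ.* m)} i∣2^j*m)))

  4∣2^suc*n : ∀ {e} n → 1 ℕ.≤ e → 4 ℕ.∣ 2 ℕ.^ suc e ℕ.* n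
  4∣2^suc*n {suc e} n _ = ℕ.∣m⇒∣m*n n (ℕ.*-monoʳ-∣ 2 (ℕ.m∣m*n {2} (2 ℕ.^ e)))

  2<2^suc*n : ∀ {e} n .{{_ : ℕ.NonZero n}} → 1 ℕ.≤ e → 2 ℕ.< 2 ℕ.^ suc e ℕ.* n
  2<2^suc*n {e} n 1≤e =
    ℕ.<⇒≤ (ℕ.∣⇒≤ {{ℕ.m*n≢0 (2 ℕ.^ suc e) n {{ℕ.m^n≢0 2 (suc e)}}}} (4∣2^suc*n n 1≤e))

  ¬InB-2^0* : ∀ {p m} → ¬ 2 ℕ.∣ m → ¬ InB p (2 ℕ.^ 0 ℕ.* m)
  ¬InB-2^0* {m = m} m-odd (_ , _ , 4∣m , _) =
    m-odd (ℕ.∣-trans (ℕ.divides 2 refl) (subst (4 ℕ.∣_) (ℕ.*-identityˡ m) 4∣m))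

  V₂Attained : ℤ → ℕ → ℕ → Set
  V₂Attained p m e = ∃ λ k → + m ∣ p ^ k - + 1 × p ^ k - + 1 hasV₂ e

  V₂Attained⇒1≤ : ∀ {p m e} → p hasV₂ 0 → V₂Attained p m e → 1 ℕ.≤ e
  V₂Attained⇒1≤ p-odd (k , _ , v) = hasV₂-≤ v (∣x-1⇒∣x^n-1 (odd⇒2∣x-1 p-odd) k)

  InB-2^suc*⇔ : ∀ {p m} → ¬ 2 ℕ.∣ ∣ p ∣ → ¬ 2 ℕ.∣ m → Coprime m ∣ p ∣ →
    ∀ e → InB p (2 ℕ.^ suc e ℕ.* m) ⇔ V₂Attained p m e
  InB-2^suc*⇔ {m = zero} _ m-odd _ _ = contradiction (2 ℕ.∣0) m-odd
  InB-2^suc*⇔ {p} {m@(suc _)} p-odd m-odd m⊥p e = mk⇔ to from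
    where
    d : ℕ
    d = 2 ℕ.^ suc e ℕ.* m
    residue⇔ : ∀ k → (2^ suc e * + m ∣ p ^ k - (2^ e * + m + + 1))
                   ⇔ (+ m ∣ p ^ k - + 1 × p ^ k - + 1 hasV₂ e)
    residue⇔ k = ≡half+1-mod⇔ {y = p ^ k} e (¬2∣⇒hasV₂0 m-odd)
    half+1≡ : + (d / 2 ℕ.+ 1) ≡ 2^ e * + m + + 1
    half+1≡ = trans (ℤ.pos-+ (d / 2) 1) (cong (_+ + 1) (trans (cong +_ (2^suc*n/2 e m)) (pos-2^*n e m)))
    in-ℤ : ∀ k → (+ d ∣ p ^ k - + (d / 2 ℕ.+ 1)) ≡ (2^ suc e * + m ∣ p ^ k - (2^ e * + m + + 1))
    in-ℤ k = cong₂ (λ a b → a ∣ p ^ k - b) (pos-2^*n (suc e) m) half+1≡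
    to : InB p d → V₂Attained p m e
    to (_ , _ , _ , k , d∣) = k , Equivalence.to (residue⇔ k) (subst id (in-ℤ k) (∣ᵤ⇒∣ d∣))
    from : V₂Attained p m e → InB p d
    from attained@(k , m∣ , v) =
      2<2^suc*n m 1≤e , coprime-2^* p-odd m⊥p (suc e) , 4∣2^suc*n m 1≤e ,
      k , ∣⇒∣ᵤ (subst id (sym (in-ℤ k)) (Equivalence.from (residue⇔ k) (m∣ , v)))
      where
      1≤e : 1 ℕ.≤ e
      1≤e = V₂Attained⇒1≤ (¬2∣⇒hasV₂0 p-odd) attained

  InB-2^*⇔ : ∀ {p m} → ¬ 2 ℕ.∣ ∣ p ∣ → ¬ 2 ℕ.∣ m → Coprime m ∣ p ∣ → (P : ℕ → Set) → ¬ P 0 →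
    (∀ e → V₂Attained p m e ⇔ P (suc e)) → ∀ j → InB p (2 ℕ.^ j ℕ.* m) ⇔ P j
  InB-2^*⇔ p-odd m-odd m⊥p P ¬P0 attained⇔ zero =
    mk⇔ (⊥-elim ∘ ¬InB-2^0* m-odd) (⊥-elim ∘ ¬P0)
  InB-2^*⇔ p-odd m-odd m⊥p P ¬P0 attained⇔ (suc e) =
    ⇔.trans (InB-2^suc*⇔ p-odd m-odd m⊥p e) (attained⇔ e)

  V₂Attained-suc : ∀ {p m e} → 2 ℕ.≤ e → V₂Attained p m e → V₂Attained p m (suc e)
  V₂Attained-suc {p} {m} {suc (suc e)} (s≤s (s≤s z≤n)) (k , m∣ , v) =
    k ℕ.* 2 , ∣-trans m∣ (subst (λ n → p ^ k - + 1 ∣ p ^ n - + 1) (ℕ.*-comm 2 k) (^-1∣^*-1 p k 2))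
            , subst (λ y → y - + 1 hasV₂ suc (suc (suc e))) (ℤ.^-*-assoc p k 2) (hasV₂-square {p ^ k} v)

  V₂Attained-mono : ∀ {p m e f} → 2 ℕ.≤ e → e ℕ.≤ f → V₂Attained p m e → V₂Attained p m f
  V₂Attained-mono {p} {m} {e} 2≤e e≤f attained = upward (ℕ.≤⇒≤′ e≤f)
    where
    upward : ∀ {f} → e ≤′ f → V₂Attained p m f
    upward ≤′-refl        = attained
    upward (≤′-step e≤′f) = V₂Attained-suc (ℕ.≤-trans 2≤e (ℕ.≤′⇒≤ e≤′f)) (upward e≤′f)

  V₂Attained-oddOrder⇔ : ∀ {p m l a b e} → p hasV₂ 0 → IsOrder p m l → ¬ 2 ℕ.∣ l →
    p - + 1 hasV₂ a → p ^ 2 - + 1 hasV₂ b → V₂Attained p m e ⇔ (e ≡ a ⊎ b ℕ.≤ e)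
  V₂Attained-oddOrder⇔ {p} {m} {l} {a} {b} {e} p-odd (_ , m∣p^l-1 , _) l-odd va vb = mk⇔ to from
    where
    2≤b : 2 ℕ.≤ b
    2≤b = hasV₂-≤ vb (odd⇒4∣x²-1 p-odd)
    to : V₂Attained p m e → e ≡ a ⊎ b ℕ.≤ e
    to (k , _ , v) with 2 ℕ.∣? k
    ... | yes (ℕ.divides q refl) = inj₂ (hasV₂-≤ v (∣-trans (hasV₂⇒2^∣ vb) (^-1∣^*-1 p 2 q)))
    ... | no  k-odd              = inj₁ (hasV₂-unique v (hasV₂-^-odd p-odd va k k-odd))
    from : e ≡ a ⊎ b ℕ.≤ e → V₂Attained p m e
    from (inj₁ refl) = l , ∣ᵤ⇒∣ m∣p^l-1 , hasV₂-^-odd p-odd va l l-odd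
    from (inj₂ b≤e)  = V₂Attained-mono 2≤b b≤e
      ( 2 ℕ.* l , ∣-trans (∣ᵤ⇒∣ m∣p^l-1) (^-1∣^*-1 p l 2)
      , subst (λ y → y - + 1 hasV₂ b) (ℤ.^-*-assoc p 2 l) (hasV₂-^-odd (hasV₂0-^ p-odd 2) vb l l-odd))

  V₂Attained-evenOrder⇔ : ∀ {p m l c e} → p hasV₂ 0 → IsOrder p m l → 2 ℕ.∣ l →
    p ^ l - + 1 hasV₂ c → V₂Attained p m e ⇔ c ℕ.≤ e
  V₂Attained-evenOrder⇔ {p} {m} {l} {c} {e} p-odd order@(_ , m∣p^l-1 , _) (ℕ.divides h refl) vc =
    mk⇔ to from
    where
    2≤c : 2 ℕ.≤ c
    2≤c = hasV₂-≤ vc (∣-trans (odd⇒4∣x²-1 p-odd) (^-1∣^*-1 p 2 h))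
    to : V₂Attained p m e → c ℕ.≤ e
    to (k , m∣ , v) with order-∣ {k = k} order m∣
    ... | ℕ.divides q refl = hasV₂-≤ v (∣-trans (hasV₂⇒2^∣ vc) (^-1∣^*-1 p l q))
    from : c ℕ.≤ e → V₂Attained p m e
    from c≤e = V₂Attained-mono 2≤c c≤e (l , ∣ᵤ⇒∣ m∣p^l-1 , vc)

open TwoAdicValuation using (IsV2⇒hasV₂; ¬2∣⇒hasV₂0)
open MembershipInB using (V₂Attained; InB-2^*⇔; V₂Attained-oddOrder⇔; V₂Attained-evenOrder⇔)

open import Defs
open import Data.Nat as ℕ using (ℕ; _≤_; _<_; _*_; _^_)
open import Data.Nat.Coprimality using (Coprime)
open import Data.Integer as ℤ using (ℤ; +_; _-_; ∣_∣)
open import Data.Integer.Divisibility using () renaming (_∣_ to _∣ℤ_)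
open import Data.Nat.Divisibility using () renaming (_∣_ to _∣ℕ_)
open import Data.Product using (_×_; _,_)
open import Data.Sum using (_⊎_; [_,_]) renaming (map to ⊎-map)
open import Function.Bundles using (_⇔_; mk⇔)
import Function.Properties.Equivalence as ⇔
open import Relation.Nullary using (¬_)
open import Relation.Binary.PropositionalEquality using (_≡_; cong)
open import Data.Nat.Properties using (suc-injective)

proposition4p7 : (p : ℤ) (m j : ℕ) →
    ¬ ((+ 2) ∣ℤ p) → 1 < ∣ p ∣ →
    1 ≤ m → ¬ (2 ∣ℕ m) → Coprime m ∣ p ∣ →
    (l : ℕ) → IsOrder p m l →
    (¬ (2 ∣ℕ l) → (a b : ℕ) → IsV2 (p - + 1) a → IsV2 (p ℤ.^ 2 - + 1) b →
      (InB p (2 ^ j * m) ⇔ (j ≡ ℕ.suc a ⊎ b < j))) ×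
    (2 ∣ℕ l → (c : ℕ) → IsV2 (p ℤ.^ l - + 1) c →
      (InB p (2 ^ j * m) ⇔ c < j))
proposition4p7 p m j p-odd _ _ m-odd m⊥p l order = odd-order , even-order
  where
  odd-order : ¬ (2 ∣ℕ l) → (a b : ℕ) → IsV2 (p - + 1) a → IsV2 (p ℤ.^ 2 - + 1) b →
    InB p (2 ^ j * m) ⇔ (j ≡ ℕ.suc a ⊎ b < j)
  odd-order l-odd a b va vb =
    InB-2^*⇔ p-odd m-odd m⊥p (λ i → i ≡ ℕ.suc a ⊎ b < i) [ (λ ()) , (λ ()) ] attained⇔ j
    where
    attained⇔ : ∀ e → V₂Attained p m e ⇔ (ℕ.suc e ≡ ℕ.suc a ⊎ b < ℕ.suc e)
    attained⇔ e = ⇔.trans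
      (V₂Attained-oddOrder⇔ (¬2∣⇒hasV₂0 p-odd) order l-odd (IsV2⇒hasV₂ va) (IsV2⇒hasV₂ vb))
      (mk⇔ (⊎-map (cong ℕ.suc) ℕ.s≤s) (⊎-map suc-injective ℕ.s≤s⁻¹))
  even-order : 2 ∣ℕ l → (c : ℕ) → IsV2 (p ℤ.^ l - + 1) c → InB p (2 ^ j * m) ⇔ c < j
  even-order l-even c vc = InB-2^*⇔ p-odd m-odd m⊥p (c <_) (λ ()) attained⇔ j
    where
    attained⇔ : ∀ e → V₂Attained p m e ⇔ c < ℕ.suc e
    attained⇔ e = ⇔.trans
      (V₂Attained-evenOrder⇔ (¬2∣⇒hasV₂0 p-odd) order l-even (IsV2⇒hasV₂ vc))
      (mk⇔ ℕ.s≤s ℕ.s≤s⁻¹)
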